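{- (i) For every integer $s\ge 2$, $r\!\left(K_{n,n},K_{s,s+1},s(s+1)-\lfloor (2s+1)/2\rfloor+2\right)=\Theta(n^2)$. (ii) For every integer $t\ge 2$, $r\!\left(K_{n,n},K_{2,t},2t-\lfloor (2+t)/2\rfloor+2\right)=\Theta(n^2)$. (iii) For every even integer $t\ge 4$, $r\!\left(K_{n,n},K_{3,t},3t-\lfloor (3+t)/2\rfloor+2\right)=\Theta(n^2)$.
   Context: For graphs $G,H$ and an integer $q$ with $2\le q\le |E(H)|$, an $(H,q)$-coloring of $G$ is an edge-coloring of $G$ in which every subgraph of $G$ isomorphic to $H$ receives at least $q$ distinct colors; $r(G,H,q)$ is the minimum number of colors needed for $G$ to have an $(H,q)$-coloring. $K_{n,n}$, $K_{s,t}$ denote complete bipartite graphs. Asymptotic notation refers to $n\to\infty$ with the other parameters fixed. -}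

module Defs where

open import Data.Nat using (ℕ; _+_; _*_; _∸_; _≤_; _/_)
open import Data.Fin using (Fin; _≟_)
open import Data.List using (List; length; deduplicate; concatMap; map; allFin)
open import Data.Product using (Σ; _×_; ∃)
open import Relation.Binary.PropositionalEquality using (_≡_)
open import Function.Definitions using (Injective)

-- An edge-colouring of K_{n,n} with (at most) k colours: the two parts are
-- two copies of Fin n, and the edge {a,b} (a in part A, b in part B) gets colour c a b.
Coloring : ℕ → ℕ → Set
Coloring n k = Fin n → Fin n → Fin k

distinctCount : ∀ {k} → List (Fin k) → ℕ
distinctCount xs = length (deduplicate _≟_ xs)

edgeColours : ∀ {n s t k} → (Fin n → Fin n → Fin k) → (Fin s → Fin n) → (Fin t → Fin n) → List (Fin k)
edgeColours {s = s} {t = t} e f g =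
  concatMap (λ i → map (λ j → e (f i) (g j)) (allFin t)) (allFin s)

-- Every subgraph of K_{n,n} isomorphic to K_{s,t} is given by an s-set S in one part
-- and a t-set T in the other part (both orientations), its edges being S × T.
-- (H,q)-colouring condition for H = K_{s,t}.
IsKstqColoring : (n s t q k : ℕ) → Coloring n k → Set
IsKstqColoring n s t q k c =
  (f : Fin s → Fin n) → (g : Fin t → Fin n) →
  Injective _≡_ _≡_ f → Injective _≡_ _≡_ g →
  (q ≤ distinctCount (edgeColours c f g)) ×
  (q ≤ distinctCount (edgeColours (λ b a → c a b) f g))

HasColoring : (n s t q k : ℕ) → Set
HasColoring n s t q k = Σ (Coloring n k) (IsKstqColoring n s t q k)

-- r(K_{n,n}, K_{s,t}, q) = Θ(n²), with r the least k such that HasColoring n s t q k: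
-- there are constants d, C, N such that for all n ≥ N,
--   every admissible k satisfies n² ≤ d·k  (i.e. r ≥ n²/d), and
--   some admissible k satisfies k ≤ C·n²   (i.e. r ≤ C n²).
RThetaSq : (s t q : ℕ) → Set
RThetaSq s t q =
  ∃ λ d → ∃ λ C → ∃ λ N → (n : ℕ) → N ≤ n →
    ((k : ℕ) → HasColoring n s t q k → n * n ≤ d * k) ×
    (∃ λ k → (k ≤ C * (n * n)) × HasColoring n s t q k)

Even : ℕ → Set
Even t = ∃ λ m → t ≡ 2 * m

-- The upper bound is the injective colouring with n² colours.  Every lower bound rests on one
-- window inequality: if a set P of cells lies in s rows and t columns and all its colours lie in
-- X, then completing those rows and columns to a copy of K_{s,t} (whose st edges show at least q
-- colours, and where each edge outside P adds at most one new colour) gives q + |P| ≤ |X| + st.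
-- When q + s = st + 2 and s ≤ t, no s cells share a colour, so all k colour classes have fewer
-- than s cells and n² ≤ sk.  When q + r + 1 = st + 2 and 2r ≤ t (the corollary takes
-- r + 1 = ⌊(s+t)/2⌋), no row contains r + 1 cells of one colour, so each row sees at least n/r
-- colours, and no two rows share r colours.  Regarding rows as subsets of the k colours, double
-- counting the incidences and Cauchy–Schwarz on the colour degrees give n² ≤ r(1 + r²)k.

module Submission where

open import Data.Bool using (Bool; true; false; _∧_)
open import Data.Bool.Properties using (∧-idem)
open import Data.Empty using (⊥; ⊥-elim)
open import Data.Fin using (Fin; zero; suc; _≟_; toℕ; fromℕ<; inject≤; combine)
open import Data.Fin.Properties using (any?; toℕ<n; toℕ-fromℕ<; toℕ-inject≤; inject≤-injective; combine-injective)
open import Data.List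
  using (List; []; _∷_; _++_; length; map; filter; deduplicate; allFin; lookup; tabulate; cartesianProduct; concatMap)
open import Data.List.Properties
  using (length-++; length-map; length-take; length-tabulate; length-deduplicate; filter-none; map-++; map-∘)
open import Data.List.Membership.Propositional using (_∈_)
open import Data.List.Membership.Propositional.Properties
open import Data.List.Membership.DecPropositional using () renaming (_∈?_ to member?)
open import Data.List.Relation.Binary.Subset.Propositional using (_⊆_)
open import Data.List.Relation.Unary.All as All using (All)
import Data.List.Relation.Unary.All.Properties as All
import Data.List.Relation.Unary.Any as Any
open import Data.List.Relation.Unary.Any using (here; there)
open import Data.List.Relation.Unary.Any.Properties using (lookup-index)
open import Data.List.Relation.Unary.Unique.Propositional using (Unique; []; _∷_)
import Data.List.Relation.Unary.Unique.Propositional.Properties as Unique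
open import Data.List.Relation.Unary.Unique.DecPropositional.Properties using (deduplicate-!)
open import Data.Nat
  using (ℕ; zero; suc; _+_; _*_; _∸_; _/_; _≤_; _<_; _>_; _≰_; z≤n; s≤s; s≤s⁻¹; NonZero; >-nonZero; >-nonZero⁻¹)
open import Data.Nat.Properties hiding (_≟_)
open import Data.Nat.Tactic.RingSolver using (solve-∀)
open import Algebra.Properties.Semiring.Sum +-*-semiring
  using (sum; sum-syntax; ∑-comm; ∑-distrib-+; *-distribˡ-sum; *-distribʳ-sum; sum-cong-≗)
open import Algebra.Properties.CommutativeSemigroup +-commutativeSemigroup using (xy∙z≈xz∙y)
open import Data.Nat.DivMod using (+-distrib-/-∣ˡ; +-distrib-/-∣ʳ; m*n/n≡m; m/n*n≤m; m≥n⇒m/n>0)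
open import Data.Nat.Divisibility using (m∣m*n; ∣-refl)
open import Data.Product using (∃; _×_; _,_; proj₁; proj₂; uncurry)
open import Data.Product.Properties using (,-injectiveˡ; ,-injectiveʳ; ×-≡,≡→≡)
open import Data.Sum using (inj₁; inj₂)
open import Function.Definitions using (Injective)
open import Relation.Nullary using (Dec; does; yes; no; _×-dec_)
open import Relation.Unary using (Decidable)
open import Relation.Unary.Properties using (∁?)
open import Relation.Binary.PropositionalEquality

open import Defs

indicator : Bool → ℕ
indicator true = 1
indicator false = 0

indicator-∧ : ∀ p q → indicator p * indicator q ≡ indicator (p ∧ q)
indicator-∧ true true = refl
indicator-∧ true false = refl
indicator-∧ false q = refl

∑-mono-≤ : ∀ {n} {f g : Fin n → ℕ} → (∀ i → f i ≤ g i) → sum f ≤ sum g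
∑-mono-≤ {zero} f≤g = z≤n
∑-mono-≤ {suc n} f≤g = +-mono-≤ (f≤g zero) (∑-mono-≤ (λ i → f≤g (suc i)))

∑-const : ∀ n (c : ℕ) → ∑[ i < n ] c ≡ n * c
∑-const zero c = refl
∑-const (suc n) c = cong (c +_) (∑-const n c)

∑-indicator-≟ : ∀ {k} (y : Fin k) → ∑[ x < k ] indicator (does (y ≟ x)) ≡ 1
∑-indicator-≟ {suc k} zero = cong suc (trans (∑-const k 0) (*-zeroʳ k))
∑-indicator-≟ {suc k} (suc y) = ∑-indicator-≟ y

private
  square-of-sum : ∀ m d → m * (m + d) + m * (m + d) + d * d ≡ m * m + (m + d) * (m + d)
  square-of-sum = solve-∀

  2mn≤m²+n²-ordered : ∀ {m n} → m ≤ n → m * n + m * n ≤ m * m + n * n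
  2mn≤m²+n²-ordered {m} m≤n with d , refl ← m≤n⇒∃[o]m+o≡n m≤n =
    ≤-trans (m≤m+n _ (d * d)) (≤-reflexive (square-of-sum m d))

2mn≤m²+n² : ∀ m n → m * n + m * n ≤ m * m + n * n
2mn≤m²+n² m n with ≤-total m n
... | inj₁ m≤n = 2mn≤m²+n²-ordered m≤n
... | inj₂ n≤m = subst₂ _≤_ (cong₂ _+_ (*-comm n m) (*-comm n m)) (+-comm (n * n) (m * m))
                   (2mn≤m²+n²-ordered n≤m)

m+m≤n+n⇒m≤n : ∀ {m n} → m + m ≤ n + n → m ≤ n
m+m≤n+n⇒m≤n m+m≤n+n = ≮⇒≥ (λ n<m → <⇒≱ (+-mono-< n<m n<m) m+m≤n+n)

-- Cauchy–Schwarz, from 2 f i f j ≤ f i² + f j² summed over all i and j.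
∑-square-≤ : ∀ {n} (f : Fin n → ℕ) → sum f * sum f ≤ n * ∑[ i < n ] (f i * f i)
∑-square-≤ {n} f = m+m≤n+n⇒m≤n (begin
  sum f * sum f + sum f * sum f
    ≡⟨ cong (λ x → x + x) (*-distribʳ-sum (sum f) f) ⟩
  ∑[ i < n ] (f i * sum f) + ∑[ i < n ] (f i * sum f)
    ≡⟨ ∑-distrib-+ (λ i → f i * sum f) (λ i → f i * sum f) ⟨
  ∑[ i < n ] (f i * sum f + f i * sum f)
    ≤⟨ ∑-mono-≤ row ⟩
  ∑[ i < n ] (n * (f i * f i) + Q)
    ≡⟨ ∑-distrib-+ (λ i → n * (f i * f i)) (λ _ → Q) ⟩
  ∑[ i < n ] (n * (f i * f i)) + ∑[ i < n ] Q
    ≡⟨ cong₂ _+_ (*-distribˡ-sum n (λ i → f i * f i)) (sym (∑-const n Q)) ⟨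
  n * Q + n * Q ∎)
  where
  open ≤-Reasoning
  Q : ℕ
  Q = ∑[ i < n ] (f i * f i)
  row : ∀ i → f i * sum f + f i * sum f ≤ n * (f i * f i) + Q
  row i = begin
    f i * sum f + f i * sum f
      ≡⟨ cong (λ x → x + x) (*-distribˡ-sum (f i) f) ⟩
    ∑[ j < n ] (f i * f j) + ∑[ j < n ] (f i * f j)
      ≡⟨ ∑-distrib-+ (λ j → f i * f j) (λ j → f i * f j) ⟨
    ∑[ j < n ] (f i * f j + f i * f j)
      ≤⟨ ∑-mono-≤ (λ j → 2mn≤m²+n² (f i) (f j)) ⟩
    ∑[ j < n ] (f i * f i + f j * f j)
      ≡⟨ ∑-distrib-+ (λ _ → f i * f i) (λ j → f j * f j) ⟩
    ∑[ j < n ] (f i * f i) + Q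
      ≡⟨ cong (_+ Q) (∑-const n (f i * f i)) ⟩
    n * (f i * f i) + Q ∎

m*m≤m*n⇒m≤n : ∀ {m n} → m * m ≤ m * n → m ≤ n
m*m≤m*n⇒m≤n {zero} _ = z≤n
m*m≤m*n⇒m≤n {suc m} = *-cancelˡ-≤ (suc m)

private
  regroup : ∀ r k m → r * (k * m) ≡ r * m * k
  regroup = solve-∀

  factor-out : ∀ k S r r' → k * (S + r * S * r') ≡ S * (k * (1 + r * r'))
  factor-out = solve-∀

module SetSystem {n k : ℕ} (A : Fin n → Fin k → Bool) where

  size : Fin n → ℕ
  size a = ∑[ x < k ] indicator (A a x)

  common : Fin n → Fin n → ℕ
  common a b = ∑[ x < k ] indicator (A a x ∧ A b x)

  degree : Fin k → ℕ
  degree x = ∑[ a < n ] indicator (A a x)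

  ∑-degree : ∑[ x < k ] degree x ≡ ∑[ a < n ] size a
  ∑-degree = sym (∑-comm (λ a x → indicator (A a x)))

  ∑-degree² : ∑[ x < k ] (degree x * degree x) ≡ ∑[ a < n ] ∑[ b < n ] common a b
  ∑-degree² = begin
    ∑[ x < k ] (degree x * degree x)
      ≡⟨ sum-cong-≗ square ⟩
    ∑[ x < k ] ∑[ a < n ] ∑[ b < n ] indicator (A a x ∧ A b x)
      ≡⟨ ∑-comm (λ x a → ∑[ b < n ] indicator (A a x ∧ A b x)) ⟩
    ∑[ a < n ] ∑[ x < k ] ∑[ b < n ] indicator (A a x ∧ A b x)
      ≡⟨ sum-cong-≗ (λ a → ∑-comm (λ x b → indicator (A a x ∧ A b x))) ⟩
    ∑[ a < n ] ∑[ b < n ] common a b ∎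
    where
    open ≡-Reasoning
    square : ∀ x → degree x * degree x ≡ ∑[ a < n ] ∑[ b < n ] indicator (A a x ∧ A b x)
    square x = begin
      degree x * degree x
        ≡⟨ *-distribʳ-sum (degree x) (λ a → indicator (A a x)) ⟩
      ∑[ a < n ] (indicator (A a x) * degree x)
        ≡⟨ sum-cong-≗ (λ a → *-distribˡ-sum (indicator (A a x)) (λ b → indicator (A b x))) ⟩
      ∑[ a < n ] ∑[ b < n ] (indicator (A a x) * indicator (A b x))
        ≡⟨ sum-cong-≗ (λ a → sum-cong-≗ (λ b → indicator-∧ (A a x) (A b x))) ⟩
      ∑[ a < n ] ∑[ b < n ] indicator (A a x ∧ A b x) ∎

  common-self : ∀ a → common a a ≡ size a
  common-self a = sum-cong-≗ (λ x → cong indicator (∧-idem (A a x)))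

  ∑-common-≤ : ∀ r' → (∀ a b → a ≢ b → common a b ≤ r') →
                ∑[ a < n ] ∑[ b < n ] common a b ≤ ∑[ a < n ] size a + n * (n * r')
  ∑-common-≤ r' common≤ = begin
    ∑[ a < n ] ∑[ b < n ] common a b          ≤⟨ ∑-mono-≤ row ⟩
    ∑[ a < n ] (size a + n * r')               ≡⟨ ∑-distrib-+ size (λ _ → n * r') ⟩
    ∑[ a < n ] size a + ∑[ a < n ] (n * r')    ≡⟨ cong (∑[ a < n ] size a +_) (∑-const n (n * r')) ⟩
    ∑[ a < n ] size a + n * (n * r')           ∎
    where
    open ≤-Reasoning
    common≤diagonal : ∀ a b → common a b ≤ indicator (does (a ≟ b)) * size a + r'
    common≤diagonal a b with a ≟ b
    ... | yes refl = ≤-trans (≤-reflexive (trans (common-self a) (sym (+-identityʳ (size a))))) (m≤m+n _ r')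
    ... | no a≢b = common≤ a b a≢b
    row : ∀ a → ∑[ b < n ] common a b ≤ size a + n * r'
    row a = begin
      ∑[ b < n ] common a b
        ≤⟨ ∑-mono-≤ (common≤diagonal a) ⟩
      ∑[ b < n ] (indicator (does (a ≟ b)) * size a + r')
        ≡⟨ ∑-distrib-+ (λ b → indicator (does (a ≟ b)) * size a) (λ _ → r') ⟩
      ∑[ b < n ] (indicator (does (a ≟ b)) * size a) + ∑[ b < n ] r'
        ≡⟨ cong₂ _+_ (sym (*-distribʳ-sum (size a) (λ b → indicator (does (a ≟ b)))))
                     (∑-const n r') ⟩
      ∑[ b < n ] indicator (does (a ≟ b)) * size a + n * r'
        ≡⟨ cong (λ m → m * size a + n * r') (∑-indicator-≟ a) ⟩
      1 * size a + n * r'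
        ≡⟨ cong (_+ n * r') (*-identityˡ (size a)) ⟩
      size a + n * r' ∎

  points-lower-bound : ∀ r r' → (∀ a → n ≤ r * size a) → (∀ a b → a ≢ b → common a b ≤ r') →
                       n * n ≤ r * (1 + r * r') * k
  points-lower-bound r r' n≤r*size common≤r' = begin
    n * n                   ≤⟨ n*n≤r*S ⟩
    r * S                   ≤⟨ *-monoʳ-≤ r S≤k*[1+r*r'] ⟩
    r * (k * (1 + r * r'))  ≡⟨ regroup r k (1 + r * r') ⟩
    r * (1 + r * r') * k    ∎
    where
    open ≤-Reasoning
    S : ℕ
    S = ∑[ a < n ] size a
    n*n≤r*S : n * n ≤ r * S
    n*n≤r*S = begin
      n * n                     ≡⟨ ∑-const n n ⟨
      ∑[ a < n ] n              ≤⟨ ∑-mono-≤ n≤r*size ⟩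
      ∑[ a < n ] (r * size a)   ≡⟨ *-distribˡ-sum r size ⟨
      r * S                     ∎
    S≤k*[1+r*r'] : S ≤ k * (1 + r * r')
    S≤k*[1+r*r'] = m*m≤m*n⇒m≤n (begin
      S * S
        ≡⟨ cong (λ m → m * m) ∑-degree ⟨
      ∑[ x < k ] degree x * ∑[ x < k ] degree x
        ≤⟨ ∑-square-≤ degree ⟩
      k * ∑[ x < k ] (degree x * degree x)
        ≡⟨ cong (k *_) ∑-degree² ⟩
      k * ∑[ a < n ] ∑[ b < n ] common a b
        ≤⟨ *-monoʳ-≤ k (∑-common-≤ r' common≤r') ⟩
      k * (S + n * (n * r'))
        ≤⟨ *-monoʳ-≤ k (+-monoʳ-≤ S (subst (_≤ r * S * r') (*-assoc n n r') (*-monoˡ-≤ r' n*n≤r*S))) ⟩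
      k * (S + r * S * r')
        ≡⟨ factor-out k S r r' ⟩
      S * (k * (1 + r * r')) ∎)

module _ {A : Set} where

  Unique⊆⇒length≤ : {xs ys : List A} → Unique xs → xs ⊆ ys → length xs ≤ length ys
  Unique⊆⇒length≤ [] _ = z≤n
  Unique⊆⇒length≤ {x ∷ xs} (x∉xs ∷ !xs) x∷xs⊆ys
    with ys₁ , ys₂ , refl ← ∈-∃++ (x∷xs⊆ys (here refl)) =
    subst (suc (length xs) ≤_) (sym length-split) (s≤s (Unique⊆⇒length≤ !xs xs⊆ys₁++ys₂))
    where
    length-split : length (ys₁ ++ x ∷ ys₂) ≡ suc (length (ys₁ ++ ys₂))
    length-split = trans (length-++ ys₁) (trans (+-suc (length ys₁) (length ys₂)) (cong suc (sym (length-++ ys₁))))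
    xs⊆ys₁++ys₂ : xs ⊆ ys₁ ++ ys₂
    xs⊆ys₁++ys₂ y∈xs with ∈-++⁻ ys₁ (x∷xs⊆ys (there y∈xs))
    ... | inj₁ y∈ys₁ = ∈-++⁺ˡ y∈ys₁
    ... | inj₂ (here refl) = ⊥-elim (All.lookup x∉xs y∈xs refl)
    ... | inj₂ (there y∈ys₂) = ∈-++⁺ʳ ys₁ y∈ys₂

  length-filter+length-filter-∁ : {P : A → Set} (P? : Decidable P) (xs : List A) →
    length (filter P? xs) + length (filter (∁? P?) xs) ≡ length xs
  length-filter+length-filter-∁ P? [] = refl
  length-filter+length-filter-∁ P? (x ∷ xs) with P? x
  ... | yes _ = cong suc (length-filter+length-filter-∁ P? xs)
  ... | no _ = trans (+-suc _ _) (cong suc (length-filter+length-filter-∁ P? xs))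

  length-filter< : ∀ {P : A → Set} (P? : Decidable P) {xs : List A} m → Unique xs →
    (∀ {ys} → Unique ys → All P ys → length ys ≡ m → ⊥) →
    length (filter P? xs) < m
  length-filter< P? {xs} m !xs no-list = ≰⇒> λ m≤length → no-list
    (Unique.take⁺ m (Unique.filter⁺ P? !xs))
    (All.take⁺ m (All.all-filter P? xs))
    (trans (length-take m (filter P? xs)) (m≤n⇒m⊓n≡m m≤length))

  map-Unique⁺ : ∀ {B : Set} (f : A → B) {xs : List A} → Unique xs →
    (∀ {x y} → x ∈ xs → y ∈ xs → f x ≡ f y → x ≡ y) → Unique (map f xs)
  map-Unique⁺ f [] _ = []
  map-Unique⁺ f {x ∷ xs} (x∉xs ∷ !xs) f-inj =
    All.tabulate fx∉ ∷ map-Unique⁺ f !xs (λ x∈ y∈ → f-inj (there x∈) (there y∈))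
    where
    fx∉ : ∀ {z} → z ∈ map f xs → f x ≢ z
    fx∉ z∈ fx≡z with y , y∈xs , refl ← ∈-map⁻ f z∈ =
      All.lookup x∉xs y∈xs (f-inj (here refl) (there y∈xs) fx≡z)

  lookup-injective : {xs : List A} → Unique xs → Injective _≡_ _≡_ (lookup xs)
  lookup-injective (_ ∷ _) {zero} {zero} _ = refl
  lookup-injective (x∉xs ∷ _) {zero} {suc j} eq = ⊥-elim (All.lookup x∉xs (∈-lookup j) eq)
  lookup-injective (x∉xs ∷ _) {suc i} {zero} eq = ⊥-elim (All.lookup x∉xs (∈-lookup i) (sym eq))
  lookup-injective (_ ∷ !xs) {suc i} {suc j} eq = cong suc (lookup-injective !xs eq)

  lookup-++ˡ : (xs ys : List A) (i : Fin (length (xs ++ ys))) (j : Fin (length xs)) →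
    toℕ i ≡ toℕ j → lookup (xs ++ ys) i ≡ lookup xs j
  lookup-++ˡ (x ∷ xs) ys zero zero _ = refl
  lookup-++ˡ (x ∷ xs) ys (suc i) (suc j) eq = lookup-++ˡ xs ys i j (suc-injective eq)

record Covering {n : ℕ} (m : ℕ) (L : List (Fin n)) : Set where
  field
    embed : Fin m → Fin n
    embed-injective : Injective _≡_ _≡_ embed
    index : Fin n → Fin m
    embed∘index : ∀ {a} → a ∈ L → embed (index a) ≡ a

covering : ∀ {n m} (L : List (Fin n)) → length L ≤ m → m ≤ n → .{{NonZero m}} → Covering m L
covering {n} {suc m} L |L|≤m m≤n = record
  { embed = embed ; embed-injective = embed-injective ; index = index ; embed∘index = embed∘index }
  where
  distinct : List (Fin n)
  distinct = deduplicate _≟_ L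
  listed? : Decidable (_∈ distinct)
  listed? a = member? _≟_ a distinct
  -- An enumeration of Fin n that starts with the distinct elements of L, so its first m entries cover L.
  enum : List (Fin n)
  enum = distinct ++ filter (∁? listed?) (allFin n)
  enum-unique : Unique enum
  enum-unique = Unique.++⁺ (deduplicate-! _≟_ L) (Unique.filter⁺ (∁? listed?) (Unique.allFin⁺ n))
    λ (a∈ , a∈rest) → proj₂ (∈-filter⁻ (∁? listed?) {xs = allFin n} a∈rest) a∈
  m≤length-enum : suc m ≤ length enum
  m≤length-enum = ≤-trans m≤n (subst (_≤ length enum) (length-tabulate {n = n} (λ i → i))
    (Unique⊆⇒length≤ (Unique.allFin⁺ n) all-enumerated))
    where
    all-enumerated : allFin n ⊆ enum
    all-enumerated {a} a∈ with listed? a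
    ... | yes a∈distinct = ∈-++⁺ˡ a∈distinct
    ... | no a∉distinct = ∈-++⁺ʳ distinct (∈-filter⁺ (∁? listed?) a∈ a∉distinct)
  embed : Fin (suc m) → Fin n
  embed i = lookup enum (inject≤ i m≤length-enum)
  embed-injective : Injective _≡_ _≡_ embed
  embed-injective eq = inject≤-injective _ _ _ _ (lookup-injective enum-unique eq)
  index : Fin n → Fin (suc m)
  index a with listed? a
  ... | yes a∈distinct = fromℕ< (≤-trans (toℕ<n (Any.index a∈distinct))
                           (≤-trans (length-deduplicate _≟_ L) |L|≤m))
  ... | no _ = zero
  embed∘index : ∀ {a} → a ∈ L → embed (index a) ≡ a
  embed∘index {a} a∈L with listed? a
  ... | no a∉distinct = ⊥-elim (a∉distinct (∈-deduplicate⁺ _≟_ a∈L))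
  ... | yes a∈distinct = trans
    (lookup-++ˡ distinct _ _ (Any.index a∈distinct) (trans (toℕ-inject≤ _ _) (toℕ-fromℕ< _)))
    (sym (lookup-index a∈distinct))

module _ {k : ℕ} where

  distinctCount-≤ : {xs ys : List (Fin k)} → xs ⊆ ys → distinctCount xs ≤ length ys
  distinctCount-≤ {xs} xs⊆ys =
    Unique⊆⇒length≤ (deduplicate-! _≟_ xs) (λ x∈ → xs⊆ys (∈-deduplicate⁻ _≟_ xs x∈))

  length≤distinctCount : {xs ys : List (Fin k)} → Unique ys → ys ⊆ xs → length ys ≤ distinctCount xs
  length≤distinctCount !ys ys⊆xs = Unique⊆⇒length≤ !ys (λ y∈ → ∈-deduplicate⁺ _≟_ (ys⊆xs y∈))

  distinctCount-map-≤ : ∀ {C : Set} (h : C → Fin k) (X : List (Fin k)) {J ps : List C} →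
    Unique J → J ⊆ ps → (∀ {p} → p ∈ J → h p ∈ X) →
    distinctCount (map h ps) + length J ≤ length X + length ps
  distinctCount-map-≤ {C} h X {J} {ps} !J J⊆ps hJ⊆X = begin
    distinctCount (map h ps) + length J
      ≤⟨ +-mono-≤ (distinctCount-≤ covered)
                  (Unique⊆⇒length≤ !J (λ p∈ → ∈-filter⁺ inX? (J⊆ps p∈) (hJ⊆X p∈))) ⟩
    length (X ++ map h outside) + length (filter inX? ps)
      ≡⟨ cong (_+ length (filter inX? ps)) (trans (length-++ X) (cong (length X +_) (length-map h outside))) ⟩
    length X + length outside + length (filter inX? ps)
      ≡⟨ +-assoc (length X) _ _ ⟩
    length X + (length outside + length (filter inX? ps))
      ≡⟨ cong (length X +_) (trans (+-comm (length outside) _) (length-filter+length-filter-∁ inX? ps)) ⟩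
    length X + length ps ∎
    where
    open ≤-Reasoning
    inX? : Decidable (λ p → h p ∈ X)
    inX? p = member? _≟_ (h p) X
    outside : List C
    outside = filter (∁? inX?) ps
    covered : map h ps ⊆ X ++ map h outside
    covered x∈ with ∈-map⁻ h x∈
    ... | p , p∈ps , refl with inX? p
    ...   | yes hp∈X = ∈-++⁺ˡ hp∈X
    ...   | no hp∉X = ∈-++⁺ʳ X (∈-map⁺ h (∈-filter⁺ (∁? inX?) p∈ps hp∉X))

length-filter-tabulate : ∀ {A : Set} {P : A → Set} (P? : Decidable P) {n} (f : Fin n → A) →
  length (filter P? (tabulate f)) ≡ ∑[ i < n ] indicator (does (P? (f i)))
length-filter-tabulate P? {zero} f = refl
length-filter-tabulate P? {suc n} f with does (P? (f zero))
... | true = cong suc (length-filter-tabulate P? (λ i → f (suc i)))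
... | false = length-filter-tabulate P? (λ i → f (suc i))

length≡∑-fibres : ∀ {C : Set} {k} (h : C → Fin k) (ps : List C) →
  length ps ≡ ∑[ x < k ] length (filter (λ p → h p ≟ x) ps)
length≡∑-fibres {k = k} h [] = sym (trans (∑-const k 0) (*-zeroʳ k))
length≡∑-fibres {k = k} h (p ∷ ps) = begin
  suc (length ps)
    ≡⟨ cong₂ _+_ (∑-indicator-≟ (h p)) (sym (length≡∑-fibres h ps)) ⟨
  ∑[ x < k ] indicator (does (h p ≟ x)) + ∑[ x < k ] length (filter (λ p → h p ≟ x) ps)
    ≡⟨ ∑-distrib-+ (λ x → indicator (does (h p ≟ x))) _ ⟨
  ∑[ x < k ] (indicator (does (h p ≟ x)) + length (filter (λ p → h p ≟ x) ps))
    ≡⟨ sum-cong-≗ fibre-step ⟩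
  ∑[ x < k ] length (filter (λ p → h p ≟ x) (p ∷ ps)) ∎
  where
  open ≡-Reasoning
  fibre-step : ∀ x → indicator (does (h p ≟ x)) + length (filter (λ p → h p ≟ x) ps)
                     ≡ length (filter (λ p → h p ≟ x) (p ∷ ps))
  fibre-step x with h p ≟ x
  ... | yes _ = refl
  ... | no _ = refl

module _ {B C : Set} where

  concatMap-map≡map-cartesianProduct : ∀ {D : Set} (H : B → C → D) (xs : List B) (ys : List C) →
    concatMap (λ x → map (H x) ys) xs ≡ map (uncurry H) (cartesianProduct xs ys)
  concatMap-map≡map-cartesianProduct H [] ys = refl
  concatMap-map≡map-cartesianProduct H (x ∷ xs) ys = trans
    (cong₂ _++_ (map-∘ ys) (concatMap-map≡map-cartesianProduct H xs ys))
    (sym (map-++ (uncurry H) (map (x ,_) ys) (cartesianProduct xs ys)))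

  length-cartesianProduct : (xs : List B) (ys : List C) →
    length (cartesianProduct xs ys) ≡ length xs * length ys
  length-cartesianProduct [] ys = refl
  length-cartesianProduct (x ∷ xs) ys =
    trans (length-++ (map (x ,_) ys)) (cong₂ _+_ (length-map _ ys) (length-cartesianProduct xs ys))

cells : ∀ s t → List (Fin s × Fin t)
cells s t = cartesianProduct (allFin s) (allFin t)

∈-cells : ∀ {s t} (p : Fin s × Fin t) → p ∈ cells s t
∈-cells (i , j) = ∈-cartesianProduct⁺ (∈-allFin i) (∈-allFin j)

cells-unique : ∀ s t → Unique (cells s t)
cells-unique s t = Unique.cartesianProduct⁺ (Unique.allFin⁺ s) (Unique.allFin⁺ t)

length-cells : ∀ s t → length (cells s t) ≡ s * t
length-cells s t = trans (length-cartesianProduct (allFin s) (allFin t))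
  (cong₂ _*_ (length-tabulate {n = s} (λ i → i)) (length-tabulate {n = t} (λ i → i)))

edgeColours≡map-cells : ∀ {n s t k} (e : Fin n → Fin n → Fin k) (f : Fin s → Fin n) (g : Fin t → Fin n) →
  edgeColours e f g ≡ map (λ (i , j) → e (f i) (g j)) (cells s t)
edgeColours≡map-cells {s = s} {t} e f g =
  concatMap-map≡map-cartesianProduct (λ i j → e (f i) (g j)) (allFin s) (allFin t)

distinctCount-edgeColours-≤ : ∀ {n s t k} (e : Fin n → Fin n → Fin k) (f : Fin s → Fin n) (g : Fin t → Fin n)
  (X : List (Fin k)) {J : List (Fin s × Fin t)} → Unique J →
  (∀ {p} → p ∈ J → e (f (proj₁ p)) (g (proj₂ p)) ∈ X) →
  distinctCount (edgeColours e f g) + length J ≤ length X + s * t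
distinctCount-edgeColours-≤ {s = s} {t} e f g X !J colours∈X
  rewrite edgeColours≡map-cells e f g | sym (length-cells s t) =
  distinctCount-map-≤ _ X !J (λ {p} _ → ∈-cells p) colours∈X

edgeColours-injective : ∀ {n s t k} (e : Fin n → Fin n → Fin k) {f : Fin s → Fin n} {g : Fin t → Fin n} →
  (∀ {a b a' b'} → e a b ≡ e a' b' → a ≡ a' × b ≡ b') → Injective _≡_ _≡_ f → Injective _≡_ _≡_ g →
  s * t ≤ distinctCount (edgeColours e f g)
edgeColours-injective {s = s} {t} e {f} {g} e-inj f-inj g-inj rewrite edgeColours≡map-cells e f g =
  subst (_≤ distinctCount (map _ (cells s t))) (trans (length-map _ (cells s t)) (length-cells s t))
    (length≤distinctCount (Unique.map⁺ cell-injective (cells-unique s t)) (λ x∈ → x∈))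
  where
  cell-injective : ∀ {p p'} → e (f (proj₁ p)) (g (proj₂ p)) ≡ e (f (proj₁ p')) (g (proj₂ p')) → p ≡ p'
  cell-injective eq = let a≡a' , b≡b' = e-inj eq in ×-≡,≡→≡ (f-inj a≡a' , g-inj b≡b')

injective-colouring : ∀ n s t q → q ≤ s * t → HasColoring n s t q (n * n)
injective-colouring n s t q q≤st = combine , λ f g f-inj g-inj →
  ≤-trans q≤st (edgeColours-injective combine (combine-injective _ _ _ _) f-inj g-inj) ,
  ≤-trans q≤st (edgeColours-injective (λ b a → combine a b)
    (λ eq → let a≡a' , b≡b' = combine-injective _ _ _ _ eq in b≡b' , a≡a') f-inj g-inj)

RThetaSq-intro : ∀ {s t q} d → q ≤ s * t →
  (∀ {n k} → t ≤ n → HasColoring n s t q k → n * n ≤ d * k) → RThetaSq s t q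
RThetaSq-intro {s} {t} {q} d q≤st lower-bound = d , 1 , t , λ n t≤n →
  (λ k → lower-bound t≤n) , n * n , ≤-reflexive (sym (*-identityˡ (n * n))) , injective-colouring n s t q q≤st

module _ {n s t q k : ℕ} {c : Coloring n k} (valid : IsKstqColoring n s t q k c)
         .{{_ : NonZero s}} .{{_ : NonZero t}} (s≤n : s ≤ n) (t≤n : t ≤ n) where

  window : (X : List (Fin k)) {P : List (Fin n × Fin n)} → Unique P → (∀ {p} → p ∈ P → uncurry c p ∈ X) →
    (rows cols : List (Fin n)) → length rows ≤ s → length cols ≤ t →
    (∀ {p} → p ∈ P → proj₁ p ∈ rows) → (∀ {p} → p ∈ P → proj₂ p ∈ cols) →
    q + length P ≤ length X + s * t
  window X {P} !P colours∈X rows cols |rows|≤s |cols|≤t row∈ col∈ = begin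
    q + length P
      ≡⟨ cong (q +_) (length-map pull-back P) ⟨
    q + length pulled
      ≤⟨ +-monoˡ-≤ (length pulled) (proj₁ (valid F.embed G.embed F.embed-injective G.embed-injective)) ⟩
    distinctCount (edgeColours c F.embed G.embed) + length pulled
      ≤⟨ distinctCount-edgeColours-≤ c F.embed G.embed X !pulled pulled-colours∈X ⟩
    length X + s * t ∎
    where
    open ≤-Reasoning
    module F = Covering (covering rows |rows|≤s s≤n)
    module G = Covering (covering cols |cols|≤t t≤n)
    pull-back : Fin n × Fin n → Fin s × Fin t
    pull-back (a , b) = F.index a , G.index b
    push-pull : ∀ {p} → p ∈ P → (F.embed (F.index (proj₁ p)) , G.embed (G.index (proj₂ p))) ≡ p
    push-pull p∈ = ×-≡,≡→≡ (F.embed∘index (row∈ p∈) , G.embed∘index (col∈ p∈))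
    pulled : List (Fin s × Fin t)
    pulled = map pull-back P
    !pulled : Unique pulled
    !pulled = map-Unique⁺ pull-back !P λ p∈ p'∈ eq →
      trans (sym (push-pull p∈)) (trans (cong (λ (i , j) → F.embed i , G.embed j) eq) (push-pull p'∈))
    pulled-colours∈X : ∀ {ij} → ij ∈ pulled → c (F.embed (proj₁ ij)) (G.embed (proj₂ ij)) ∈ X
    pulled-colours∈X ij∈ with p , p∈ , refl ← ∈-map⁻ pull-back ij∈ =
      subst (_∈ X) (cong (uncurry c) (sym (push-pull p∈))) (colours∈X p∈)

m≡n+2⇒m≰1+n : ∀ {m n} → m ≡ n + 2 → m ≰ 1 + n
m≡n+2⇒m≰1+n {n = n} refl m≤1+n = 1+n≰n (s≤s⁻¹ (≤-trans (≤-reflexive (+-comm 2 n)) m≤1+n))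

private
  regroup-suc : ∀ q r → suc (q + (r + r)) ≡ q + suc r + r
  regroup-suc = solve-∀

q+1+r≡P+2⇒q+[r+r]≰r+P : ∀ {q r P} → q + suc r ≡ P + 2 → q + (r + r) ≰ r + P
q+1+r≡P+2⇒q+[r+r]≰r+P {q} {r} {P} eq le =
  m≡n+2⇒m≰1+n (trans (cong (_+ r) eq) (xy∙z≈xz∙y P 2 r))
    (subst (_≤ 1 + (P + r)) (regroup-suc q r) (s≤s (subst (q + (r + r) ≤_) (+-comm r P) le)))

module _ {n s t q k : ℕ} {c : Coloring n k} (valid : IsKstqColoring n s t q k c)
         (2≤s : 2 ≤ s) (s≤t : s ≤ t) (t≤n : t ≤ n) where

  private instance
    s-nonZero : NonZero s
    s-nonZero = >-nonZero (≤-trans (s≤s z≤n) 2≤s)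
    t-nonZero : NonZero t
    t-nonZero = >-nonZero (≤-trans (s≤s z≤n) (≤-trans 2≤s s≤t))

  s≤n : s ≤ n
  s≤n = ≤-trans s≤t t≤n

  module ColourClasses (q+s≡st+2 : q + s ≡ s * t + 2) where

    colourClass-< : ∀ x → length (filter (λ p → uncurry c p ≟ x) (cells n n)) < s
    colourClass-< x = length-filter< _ s (cells-unique n n) λ {P} !P coloured-x |P|≡s →
      m≡n+2⇒m≰1+n (subst (λ m → q + m ≡ s * t + 2) (sym |P|≡s) q+s≡st+2)
        (window valid s≤n t≤n (x ∷ []) !P (λ p∈ → here (All.lookup coloured-x p∈))
          (map proj₁ P) (map proj₂ P)
          (≤-reflexive (trans (length-map proj₁ P) |P|≡s))
          (≤-trans (≤-reflexive (trans (length-map proj₂ P) |P|≡s)) s≤t)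
          (∈-map⁺ proj₁) (∈-map⁺ proj₂))

    n*n≤s*k : n * n ≤ s * k
    n*n≤s*k = begin
      n * n
        ≡⟨ length-cells n n ⟨
      length (cells n n)
        ≡⟨ length≡∑-fibres (uncurry c) (cells n n) ⟩
      ∑[ x < k ] length (filter (λ p → uncurry c p ≟ x) (cells n n))
        ≤⟨ ∑-mono-≤ (λ x → <⇒≤ (colourClass-< x)) ⟩
      ∑[ x < k ] s
        ≡⟨ trans (∑-const k s) (*-comm k s) ⟩
      s * k ∎
      where open ≤-Reasoning

  module SharedColours (r : ℕ) .{{_ : NonZero r}} (r+r≤t : r + r ≤ t)
                       (q+1+r≡st+2 : q + suc r ≡ s * t + 2) where

    Occurs : Fin n → Fin k → Set
    Occurs a x = ∃ λ j → c a j ≡ x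

    occurs? : ∀ a x → Dec (Occurs a x)
    occurs? a x = any? (λ j → c a j ≟ x)

    -- The fallback value a is junk: witness-colour only speaks about colours that occur in row a.
    witness : Fin n → Fin k → Fin n
    witness a x with occurs? a x
    ... | yes (j , _) = j
    ... | no _ = a

    witness-colour : ∀ {a x} → Occurs a x → c a (witness a x) ≡ x
    witness-colour {a} {x} occurs with occurs? a x
    ... | yes (_ , cj≡x) = cj≡x
    ... | no ¬occurs = ⊥-elim (¬occurs occurs)

    open SetSystem (λ a x → does (occurs? a x))

    rowClass-≤ : ∀ a x → length (filter (λ j → c a j ≟ x) (allFin n)) ≤ r
    rowClass-≤ a x = s≤s⁻¹ (length-filter< _ (suc r) (Unique.allFin⁺ n) λ {js} !js coloured-x |js|≡1+r →
      m≡n+2⇒m≰1+n (subst (λ m → q + m ≡ s * t + 2) (sym (trans (length-map (a ,_) js) |js|≡1+r)) q+1+r≡st+2)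
        (window valid s≤n t≤n (x ∷ []) (Unique.map⁺ ,-injectiveʳ !js) (colour-x coloured-x)
          (a ∷ []) js (≤-trans (s≤s z≤n) 2≤s)
          (≤-trans (≤-reflexive |js|≡1+r) (≤-trans (m<m+n r (>-nonZero⁻¹ r)) r+r≤t))
          row-a col∈js))
      where
      colour-x : ∀ {js} → All (λ j → c a j ≡ x) js → ∀ {p} → p ∈ map (a ,_) js → uncurry c p ∈ x ∷ []
      colour-x coloured-x p∈ with j , j∈ , refl ← ∈-map⁻ (a ,_) p∈ = here (All.lookup coloured-x j∈)
      row-a : ∀ {js p} → p ∈ map (a ,_) js → proj₁ p ∈ a ∷ []
      row-a p∈ with _ , _ , refl ← ∈-map⁻ (a ,_) p∈ = here refl
      col∈js : ∀ {js p} → p ∈ map (a ,_) js → proj₂ p ∈ js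
      col∈js p∈ with _ , j∈ , refl ← ∈-map⁻ (a ,_) p∈ = j∈

    n≤r*size : ∀ a → n ≤ r * size a
    n≤r*size a = begin
      n
        ≡⟨ length-tabulate {n = n} (λ j → j) ⟨
      length (allFin n)
        ≡⟨ length≡∑-fibres (c a) (allFin n) ⟩
      ∑[ x < k ] length (filter (λ j → c a j ≟ x) (allFin n))
        ≤⟨ ∑-mono-≤ rowClass-≤-indicator ⟩
      ∑[ x < k ] (r * indicator (does (occurs? a x)))
        ≡⟨ *-distribˡ-sum r (λ x → indicator (does (occurs? a x))) ⟨
      r * size a ∎
      where
      open ≤-Reasoning
      rowClass-≤-indicator : ∀ x →
        length (filter (λ j → c a j ≟ x) (allFin n)) ≤ r * indicator (does (occurs? a x))
      rowClass-≤-indicator x with occurs? a x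
      ... | yes _ = subst (_ ≤_) (sym (*-identityʳ r)) (rowClass-≤ a x)
      ... | no ¬occurs = ≤-trans (≤-reflexive (cong length (filter-none (λ j → c a j ≟ x) {xs = allFin n}
                           (All.tabulate λ {j} _ cj≡x → ¬occurs (j , cj≡x))))) z≤n

    Shared : Fin n → Fin n → Fin k → Set
    Shared a b x = Occurs a x × Occurs b x

    shared? : ∀ a b → Decidable (Shared a b)
    shared? a b x = occurs? a x ×-dec occurs? b x

    at : Fin n → Fin k → Fin n × Fin n
    at a x = a , witness a x

    at-injective : ∀ {a x y} → Occurs a x → Occurs a y → at a x ≡ at a y → x ≡ y
    at-injective {a} occurs-x occurs-y eq =
      trans (sym (witness-colour occurs-x)) (trans (cong (c a) (,-injectiveʳ eq)) (witness-colour occurs-y))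

    witnessCells : Fin n → Fin n → List (Fin k) → List (Fin n × Fin n)
    witnessCells a b xs = map (at a) xs ++ map (at b) xs

    length-witnessCells : ∀ a b xs → length (witnessCells a b xs) ≡ length xs + length xs
    length-witnessCells a b xs =
      trans (length-++ (map (at a) xs)) (cong₂ _+_ (length-map (at a) xs) (length-map (at b) xs))

    witnessCells-unique : ∀ {a b xs} → a ≢ b → Unique xs → All (Shared a b) xs → Unique (witnessCells a b xs)
    witnessCells-unique {a} {b} {xs} a≢b !xs shared = Unique.++⁺
      (map-Unique⁺ (at a) !xs λ x∈ y∈ → at-injective (proj₁ (All.lookup shared x∈)) (proj₁ (All.lookup shared y∈)))
      (map-Unique⁺ (at b) !xs λ x∈ y∈ → at-injective (proj₂ (All.lookup shared x∈)) (proj₂ (All.lookup shared y∈)))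
      λ (p∈a , p∈b) → different-rows p∈a p∈b
      where
      different-rows : ∀ {p} → p ∈ map (at a) xs → p ∈ map (at b) xs → ⊥
      different-rows p∈a p∈b with _ , _ , refl ← ∈-map⁻ (at a) p∈a | _ , _ , eq ← ∈-map⁻ (at b) p∈b =
        a≢b (,-injectiveˡ eq)

    witnessCells-colours : ∀ {a b xs} → All (Shared a b) xs → ∀ {p} → p ∈ witnessCells a b xs → uncurry c p ∈ xs
    witnessCells-colours {a} {b} {xs} shared p∈ with ∈-++⁻ (map (at a) xs) p∈
    ... | inj₁ p∈a with x , x∈ , refl ← ∈-map⁻ (at a) p∈a =
      subst (_∈ xs) (sym (witness-colour (proj₁ (All.lookup shared x∈)))) x∈
    ... | inj₂ p∈b with x , x∈ , refl ← ∈-map⁻ (at b) p∈b =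
      subst (_∈ xs) (sym (witness-colour (proj₂ (All.lookup shared x∈)))) x∈

    witnessCells-rows : ∀ {a b} xs {p} → p ∈ witnessCells a b xs → proj₁ p ∈ a ∷ b ∷ []
    witnessCells-rows {a} {b} xs p∈ with ∈-++⁻ (map (at a) xs) p∈
    ... | inj₁ p∈a with _ , _ , refl ← ∈-map⁻ (at a) p∈a = here refl
    ... | inj₂ p∈b with _ , _ , refl ← ∈-map⁻ (at b) p∈b = there (here refl)

    common-< : ∀ {a b} → a ≢ b → common a b < r
    common-< {a} {b} a≢b = subst (_< r) (length-filter-tabulate (shared? a b) (λ x → x))
      (length-filter< (shared? a b) r (Unique.allFin⁺ k) λ {xs} !xs shared |xs|≡r →
        let |cells|≡r+r = trans (length-witnessCells a b xs) (cong₂ _+_ |xs|≡r |xs|≡r) in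
        q+1+r≡P+2⇒q+[r+r]≰r+P q+1+r≡st+2
          (subst₂ (λ m l → q + m ≤ l + s * t) |cells|≡r+r |xs|≡r
            (window valid s≤n t≤n xs (witnessCells-unique a≢b !xs shared) (witnessCells-colours shared)
              (a ∷ b ∷ []) (map proj₂ (witnessCells a b xs)) 2≤s
              (subst (_≤ t) (sym (trans (length-map proj₂ (witnessCells a b xs)) |cells|≡r+r)) r+r≤t)
              (witnessCells-rows xs) (∈-map⁺ proj₂))))

    n*n≤r*[1+r*r]*k : n * n ≤ r * (1 + r * r) * k
    n*n≤r*[1+r*r]*k = points-lower-bound r r n≤r*size (λ _ _ a≢b → <⇒≤ (common-< a≢b))

q+m≡P+2⇒q≤P : ∀ {q m P} → 2 ≤ m → q + m ≡ P + 2 → q ≤ P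
q+m≡P+2⇒q≤P {q} {m} {P} 2≤m eq = +-cancelʳ-≤ m q P (subst (_≤ P + m) (sym eq) (+-monoʳ-≤ P 2≤m))

RThetaSq-colourClasses : ∀ {s t q} → 2 ≤ s → s ≤ t → q + s ≡ s * t + 2 → RThetaSq s t q
RThetaSq-colourClasses {s} 2≤s s≤t q+s≡st+2 = RThetaSq-intro s (q+m≡P+2⇒q≤P 2≤s q+s≡st+2)
  λ t≤n (c , valid) → ColourClasses.n*n≤s*k {c = c} valid 2≤s s≤t t≤n q+s≡st+2

RThetaSq-sharedColours : ∀ {s t q} r .{{_ : NonZero r}} → 2 ≤ s → s ≤ t → r + r ≤ t →
  q + suc r ≡ s * t + 2 → RThetaSq s t q
RThetaSq-sharedColours r 2≤s s≤t r+r≤t q+1+r≡st+2 =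
  RThetaSq-intro (r * (1 + r * r)) (q+m≡P+2⇒q≤P (s≤s (>-nonZero⁻¹ r)) q+1+r≡st+2)
    λ t≤n (c , valid) → SharedColours.n*n≤r*[1+r*r]*k {c = c} valid 2≤s s≤t t≤n r r+r≤t q+1+r≡st+2

P∸h+2+m≡P+2 : ∀ {P h m} → h ≡ m → m ≤ P → P ∸ h + 2 + m ≡ P + 2
P∸h+2+m≡P+2 {P} {m = m} refl m≤P =
  trans (xy∙z≈xz∙y (P ∸ m) 2 m) (cong (_+ 2) (m∸n+n≡m m≤P))

[2s+1]/2≡s : ∀ s → (2 * s + 1) / 2 ≡ s
[2s+1]/2≡s s = begin
  (2 * s + 1) / 2   ≡⟨ +-distrib-/-∣ˡ 1 {2} (m∣m*n s) ⟩
  2 * s / 2 + 0     ≡⟨ +-identityʳ _ ⟩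
  2 * s / 2         ≡⟨ cong (_/ 2) (*-comm 2 s) ⟩
  s * 2 / 2         ≡⟨ m*n/n≡m s 2 ⟩
  s                 ∎
  where open ≡-Reasoning

[2+t]/2≡1+t/2 : ∀ t → (2 + t) / 2 ≡ suc (t / 2)
[2+t]/2≡1+t/2 t = +-distrib-/-∣ˡ t {2} ∣-refl

[3+2m]/2≡1+m : ∀ m → (3 + 2 * m) / 2 ≡ suc m
[3+2m]/2≡1+m m = trans (+-distrib-/-∣ʳ 3 {d = 2} (m∣m*n m))
  (cong suc (trans (cong (_/ 2) (*-comm 2 m)) (m*n/n≡m m 2)))

t/2+t/2≤t : ∀ t → t / 2 + t / 2 ≤ t
t/2+t/2≤t t = subst (_≤ t) (trans (*-comm (t / 2) 2) (cong (t / 2 +_) (+-identityʳ (t / 2)))) (m/n*n≤m t 2)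

corollary1p4 :
    ((s : ℕ) → 2 ≤ s → RThetaSq s (s + 1) (s * (s + 1) ∸ ((2 * s + 1) / 2) + 2)) ×
    ((t : ℕ) → 2 ≤ t → RThetaSq 2 t (2 * t ∸ ((2 + t) / 2) + 2)) ×
    ((t : ℕ) → Even t → 4 ≤ t → RThetaSq 3 t (3 * t ∸ ((3 + t) / 2) + 2))
corollary1p4 = part-i , part-ii , part-iii
  where
  part-i : (s : ℕ) → 2 ≤ s → RThetaSq s (s + 1) (s * (s + 1) ∸ ((2 * s + 1) / 2) + 2)
  part-i s 2≤s = RThetaSq-colourClasses 2≤s (m≤m+n s 1)
    (P∸h+2+m≡P+2 ([2s+1]/2≡s s) (m≤m*n s (s + 1) {{>-nonZero (m≤n+m 1 s)}}))
  part-ii : (t : ℕ) → 2 ≤ t → RThetaSq 2 t (2 * t ∸ ((2 + t) / 2) + 2)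
  part-ii t 2≤t = RThetaSq-sharedColours r {{>-nonZero r>0}} ≤-refl 2≤t (t/2+t/2≤t t)
    (P∸h+2+m≡P+2 ([2+t]/2≡1+t/2 t) (≤-trans (m<m+n r r>0) (≤-trans (t/2+t/2≤t t) (m≤n*m t 2))))
    where
    r : ℕ
    r = t / 2
    r>0 : r > 0
    r>0 = m≥n⇒m/n>0 2≤t
  part-iii : (t : ℕ) → Even t → 4 ≤ t → RThetaSq 3 t (3 * t ∸ ((3 + t) / 2) + 2)
  part-iii .(2 * suc m) (suc m , refl) 4≤t =
    RThetaSq-sharedColours (suc m) (s≤s (s≤s z≤n)) (≤-trans (n≤1+n 3) 4≤t) r+r≤t
      (P∸h+2+m≡P+2 ([3+2m]/2≡1+m (suc m)) (≤-trans (m<m+n (suc m) (s≤s z≤n)) (≤-trans r+r≤t (m≤n*m (2 * suc m) 3))))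
    where
    r+r≤t : suc m + suc m ≤ 2 * suc m
    r+r≤t = ≤-reflexive (cong (suc m +_) (sym (+-identityʳ (suc m))))
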